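{- For every integer $M>1$, the sequence $u_n(t)=\dfrac{t^n-1}{t^{(n,M)}-1}$, $n\ge0$, is a linear division sequence in $\mathbb Z[t]$.
   Context: A linear division sequence in $\mathbb Z[t]$ is a sequence of polynomials satisfying a linear recurrence with constant coefficients ($u_n=c_1u_{n-1}+\dots+c_ku_{n-k}$, coefficients polynomials, $c_k\ne0$) such that $u_m\mid u_n$ whenever $m\mid n$. Here $(n,M)=\gcd(n,M)$. -}

module Defs where

open import Data.Nat as ℕ using (ℕ; zero; suc; _∸_)
open import Data.Nat.GCD using (gcd)
open import Data.Nat.Divisibility as ℕD using (_∣?_)
open import Data.Integer as ℤ using (ℤ; +_)
open import Data.List using (List; []; _∷_)
open import Data.Fin using (Fin; toℕ; fromℕ)
open import Data.Bool using (if_then_else_)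
open import Data.Product using (Σ; ∃; _×_)
open import Relation.Nullary using (¬_; does)
open import Relation.Binary.PropositionalEquality using (_≡_)

-- Polynomials in ℤ[t]: coefficient lists, lowest degree first.
-- Equality is coefficientwise (so trailing zeros are irrelevant).
Poly : Set
Poly = List ℤ

coeff : Poly → ℕ → ℤ
coeff []      _       = + 0
coeff (a ∷ p) zero    = a
coeff (a ∷ p) (suc i) = coeff p i

infix 4 _≈_
_≈_ : Poly → Poly → Set
p ≈ q = ∀ i → coeff p i ≡ coeff q i

0P : Poly
0P = []

1P : Poly
1P = + 1 ∷ []

tP : Poly
tP = + 0 ∷ + 1 ∷ []

infixl 6 _+P_ _-P_
infixl 7 _*P_
infixr 8 _^P_

_+P_ : Poly → Poly → Poly
[]      +P q       = q
(a ∷ p) +P []      = a ∷ p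
(a ∷ p) +P (b ∷ q) = (a ℤ.+ b) ∷ (p +P q)

scale : ℤ → Poly → Poly
scale a []      = []
scale a (b ∷ q) = (a ℤ.* b) ∷ scale a q

negP : Poly → Poly
negP = scale (ℤ.- (+ 1))

_-P_ : Poly → Poly → Poly
p -P q = p +P negP q

_*P_ : Poly → Poly → Poly
[]      *P q = []
(a ∷ p) *P q = scale a q +P (+ 0 ∷ (p *P q))

_^P_ : Poly → ℕ → Poly
p ^P zero  = 1P
p ^P suc n = p *P (p ^P n)

infix 4 _∣P_
_∣P_ : Poly → Poly → Set
a ∣P b = ∃ λ q → q *P a ≈ b

sumFin : (n : ℕ) → (Fin n → Poly) → Poly
sumFin zero    f = 0P
sumFin (suc n) f = f Data.Fin.zero +P sumFin n (λ i → f (Data.Fin.suc i))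


sumNat : ℕ → (ℕ → Poly) → Poly
sumNat zero    f = 0P
sumNat (suc n) f = sumNat n f +P f n

-- u satisfies a linear recurrence of some order k+1 ≥ 1 with constant
-- coefficients c₁,…,c_{k+1} ∈ ℤ[t] (c i encodes c_{i+1}), c_{k+1} ≠ 0:
--   u (n + k + 1) = Σ_{i=1}^{k+1} c_i u (n + k + 1 - i)   for all n.
SatisfiesLinRec : (ℕ → Poly) → Set
SatisfiesLinRec u =
  Σ ℕ λ k → Σ (Fin (suc k) → Poly) λ c →
    (¬ (c (fromℕ k) ≈ 0P)) ×
    (∀ n → u (suc k ℕ.+ n) ≈
           sumFin (suc k) (λ i → c i *P u ((suc k ℕ.+ n) ∸ suc (toℕ i))))

IsDivisionSeq : (ℕ → Poly) → Set
IsDivisionSeq u = ∀ m n → m ℕD.∣ n → u m ∣P u n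

IsLinearDivisionSeq : (ℕ → Poly) → Set
IsLinearDivisionSeq u = SatisfiesLinRec u × IsDivisionSeq u

-- u_n(t) = (t^n - 1)/(t^{(n,M)} - 1), given explicitly as the quotient
--   Σ_{0 ≤ j < n, (n,M) ∣ j} t^j   (which is 0 for n = 0).
-- The statement additionally asserts that this is that quotient.
uSeq : ℕ → ℕ → Poly
uSeq M n = sumNat n (λ j → if does (gcd n M ∣? j) then tP ^P j else 0P)

-- With d = (n, M) and n = k d, u_n is the geometric sum 1 + y + ⋯ + y^(k-1)
-- in y = t^d, which gives the quotient (t^n - 1)/(t^d - 1) at once. Since
-- (M + n, M) = (n, M), shifting n by M keeps y and appends M/d terms, whence
-- u_{n+2M} = (1 + t^M) u_{n+M} - t^M u_n, a recurrence of order 2M.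
-- For m ∣ n put a = (m, M), m = p a, (n, M) = c a and n = q (n, M); then p and
-- c are coprime and p ∣ q. Geometric sums of coprime lengths in the same X are
-- comaximal (a Bézout identity between the lengths lifts to them), so
-- Σ_{j<p} X^j divides Σ_{j<p} X^(cj), which divides Σ_{j<q} X^(cj); with
-- X = t^a these are u_m and u_n.

module Submission where

open import Defs
open import Data.Nat using (ℕ; _<_)
open import Data.Nat.GCD using (gcd)
open import Data.Product using (_×_)

open import Algebra.Bundles using (CommutativeRing)
open import Data.Bool using (if_then_else_)
open import Data.Fin as Fin using (Fin; toℕ; fromℕ; fromℕ<)
open import Data.Fin.Properties using (toℕ-fromℕ; toℕ-fromℕ<; _≟_)
open import Data.Integer as ℤ using (+_; +0)
import Data.Integer.Properties as ℤ
import Data.Integer.Tactic.RingSolver as ℤ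
open import Data.List using ([]; _∷_)
open import Data.Maybe using (Maybe; just; nothing)
open import Data.Nat as ℕ using (zero; suc; _∸_; NonZero)
import Data.Nat.Properties as ℕ
open import Data.Nat.Coprimality using (Coprime; coprime-Bézout; coprime-divisor)
open import Data.Nat.Divisibility as ℕ using (_∣_; divides; _∣?_)
open import Data.Nat.GCD using (module GCD; module Bézout; gcd-GCD; gcd[m,n]∣m; gcd[m,n]∣n; gcd-greatest; gcd[m,n]≢0)
open import Data.Product using (∃₂; _,_)
open import Data.Sum using (inj₂)
open import Level using (0ℓ)
open import Relation.Binary.PropositionalEquality as ≡ using (_≡_; _≢_; refl; cong; cong₂)
open import Relation.Nullary using (does; ¬_)
open import Relation.Nullary.Decidable using (dec-true; dec-false)
open import Tactic.RingSolver using (solve-∀)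
open import Tactic.RingSolver.Core.AlmostCommutativeRing using (AlmostCommutativeRing; fromCommutativeRing)

-- The ring ℤ[t]

-- `p ≈ q` unfolds to a Π-type from which p and q cannot be inferred, so the
-- ring structure is built on this wrapped copy of coefficientwise equality.
infix 4 _≋_
record _≋_ (p q : Poly) : Set where
  constructor mk≋
  field coeff-≡ : p ≈ q
open _≋_

≋-refl : ∀ {p} → p ≋ p
≋-refl = mk≋ λ _ → refl

≋-sym : ∀ {p q} → p ≋ q → q ≋ p
≋-sym (mk≋ e) = mk≋ λ i → ≡.sym (e i)

≋-trans : ∀ {p q r} → p ≋ q → q ≋ r → p ≋ r
≋-trans (mk≋ e) (mk≋ f) = mk≋ λ i → ≡.trans (e i) (f i)

≡⇒≋ : ∀ {p q} → p ≡ q → p ≋ q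
≡⇒≋ refl = ≋-refl

coeff-+P : ∀ p q i → coeff (p +P q) i ≡ coeff p i ℤ.+ coeff q i
coeff-+P []      q       i       = ≡.sym (ℤ.+-identityˡ _)
coeff-+P (a ∷ p) []      i       = ≡.sym (ℤ.+-identityʳ _)
coeff-+P (a ∷ p) (b ∷ q) zero    = refl
coeff-+P (a ∷ p) (b ∷ q) (suc i) = coeff-+P p q i

coeff-scale : ∀ a p i → coeff (scale a p) i ≡ a ℤ.* coeff p i
coeff-scale a []      i       = ≡.sym (ℤ.*-zeroʳ a)
coeff-scale a (b ∷ p) zero    = refl
coeff-scale a (b ∷ p) (suc i) = coeff-scale a p i

∷-cong : ∀ {a b p q} → a ≡ b → p ≋ q → (a ∷ p) ≋ (b ∷ q)
∷-cong a≡b (mk≋ p≈q) = mk≋ λ { zero → a≡b ; (suc i) → p≈q i }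

+P-cong : ∀ {p p′ q q′} → p ≋ p′ → q ≋ q′ → p +P q ≋ p′ +P q′
+P-cong {p} {p′} {q} {q′} (mk≋ e) (mk≋ f) = mk≋ λ i →
  ≡.trans (coeff-+P p q i) (≡.trans (cong₂ ℤ._+_ (e i) (f i)) (≡.sym (coeff-+P p′ q′ i)))

scale-cong : ∀ a {p q} → p ≋ q → scale a p ≋ scale a q
scale-cong a {p} {q} (mk≋ e) = mk≋ λ i →
  ≡.trans (coeff-scale a p i) (≡.trans (cong (ℤ._*_ a) (e i)) (≡.sym (coeff-scale a q i)))

+P-comm : ∀ p q → p +P q ≋ q +P p
+P-comm p q = mk≋ λ i → ≡.trans (coeff-+P p q i)
  (≡.trans (ℤ.+-comm (coeff p i) (coeff q i)) (≡.sym (coeff-+P q p i)))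

+P-assoc : ∀ p q r → (p +P q) +P r ≋ p +P (q +P r)
+P-assoc p q r = mk≋ λ i → begin
  coeff ((p +P q) +P r) i                      ≡⟨ coeff-+P (p +P q) r i ⟩
  coeff (p +P q) i ℤ.+ coeff r i               ≡⟨ cong (ℤ._+ coeff r i) (coeff-+P p q i) ⟩
  (coeff p i ℤ.+ coeff q i) ℤ.+ coeff r i      ≡⟨ ℤ.+-assoc (coeff p i) (coeff q i) (coeff r i) ⟩
  coeff p i ℤ.+ (coeff q i ℤ.+ coeff r i)      ≡⟨ cong (ℤ._+_ (coeff p i)) (coeff-+P q r i) ⟨
  coeff p i ℤ.+ coeff (q +P r) i               ≡⟨ coeff-+P p (q +P r) i ⟨
  coeff (p +P (q +P r)) i                      ∎
  where open ≡.≡-Reasoning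

+P-identityʳ : ∀ p → p +P 0P ≋ p
+P-identityʳ p = mk≋ λ i → ≡.trans (coeff-+P p 0P i) (ℤ.+-identityʳ _)

+P-inverseʳ : ∀ p → p +P negP p ≋ 0P
+P-inverseʳ p = mk≋ λ i → begin
  coeff (p +P negP p) i                       ≡⟨ coeff-+P p (negP p) i ⟩
  coeff p i ℤ.+ coeff (negP p) i              ≡⟨ cong (ℤ._+_ (coeff p i)) (coeff-scale (ℤ.- + 1) p i) ⟩
  coeff p i ℤ.+ ℤ.- + 1 ℤ.* coeff p i         ≡⟨ x-x≡0 (coeff p i) ⟩
  + 0                                         ∎
  where
  open ≡.≡-Reasoning
  x-x≡0 : ∀ x → x ℤ.+ ℤ.- + 1 ℤ.* x ≡ + 0
  x-x≡0 = ℤ.solve-∀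

scale-distrib-+P : ∀ a p q → scale a (p +P q) ≋ scale a p +P scale a q
scale-distrib-+P a p q = mk≋ λ i → begin
  coeff (scale a (p +P q)) i                  ≡⟨ coeff-scale a (p +P q) i ⟩
  a ℤ.* coeff (p +P q) i                      ≡⟨ cong (ℤ._*_ a) (coeff-+P p q i) ⟩
  a ℤ.* (coeff p i ℤ.+ coeff q i)             ≡⟨ ℤ.*-distribˡ-+ a (coeff p i) (coeff q i) ⟩
  a ℤ.* coeff p i ℤ.+ a ℤ.* coeff q i         ≡⟨ cong₂ ℤ._+_ (coeff-scale a p i) (coeff-scale a q i) ⟨
  coeff (scale a p) i ℤ.+ coeff (scale a q) i ≡⟨ coeff-+P (scale a p) (scale a q) i ⟨
  coeff (scale a p +P scale a q) i            ∎
  where open ≡.≡-Reasoning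

scale-scale : ∀ a b p → scale a (scale b p) ≋ scale (a ℤ.* b) p
scale-scale a b p = mk≋ λ i → begin
  coeff (scale a (scale b p)) i               ≡⟨ coeff-scale a (scale b p) i ⟩
  a ℤ.* coeff (scale b p) i                   ≡⟨ cong (ℤ._*_ a) (coeff-scale b p i) ⟩
  a ℤ.* (b ℤ.* coeff p i)                     ≡⟨ ℤ.*-assoc a b (coeff p i) ⟨
  a ℤ.* b ℤ.* coeff p i                       ≡⟨ coeff-scale (a ℤ.* b) p i ⟨
  coeff (scale (a ℤ.* b) p) i                 ∎
  where open ≡.≡-Reasoning

scale-zero : ∀ p → scale (+ 0) p ≋ 0P
scale-zero p = mk≋ λ i → ≡.trans (coeff-scale (+ 0) p i) (ℤ.*-zeroˡ (coeff p i))

scale-one : ∀ p → scale (+ 1) p ≋ p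
scale-one p = mk≋ λ i → ≡.trans (coeff-scale (+ 1) p i) (ℤ.*-identityˡ (coeff p i))

+P-interchange : ∀ p q r s → (p +P q) +P (r +P s) ≋ (p +P r) +P (q +P s)
+P-interchange p q r s = mk≋ λ i → begin
  coeff ((p +P q) +P (r +P s)) i                        ≡⟨ expand p q r s i ⟩
  (coeff p i ℤ.+ coeff q i) ℤ.+ (coeff r i ℤ.+ coeff s i) ≡⟨ swap (coeff p i) (coeff q i) (coeff r i) (coeff s i) ⟩
  (coeff p i ℤ.+ coeff r i) ℤ.+ (coeff q i ℤ.+ coeff s i) ≡⟨ expand p r q s i ⟨
  coeff ((p +P r) +P (q +P s)) i                        ∎
  where
  open ≡.≡-Reasoning
  expand : ∀ p q r s i → coeff ((p +P q) +P (r +P s)) i ≡ (coeff p i ℤ.+ coeff q i) ℤ.+ (coeff r i ℤ.+ coeff s i)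
  expand p q r s i = ≡.trans (coeff-+P (p +P q) (r +P s) i) (cong₂ ℤ._+_ (coeff-+P p q i) (coeff-+P r s i))
  swap : ∀ a b c d → (a ℤ.+ b) ℤ.+ (c ℤ.+ d) ≡ (a ℤ.+ c) ℤ.+ (b ℤ.+ d)
  swap = ℤ.solve-∀

*P-congʳ : ∀ p {q q′} → q ≋ q′ → p *P q ≋ p *P q′
*P-congʳ []      q≋q′ = ≋-refl
*P-congʳ (a ∷ p) q≋q′ = +P-cong (scale-cong a q≋q′) (∷-cong refl (*P-congʳ p q≋q′))

*P-distribˡ-+P : ∀ p q r → p *P (q +P r) ≋ p *P q +P p *P r
*P-distribˡ-+P []      q r = ≋-refl
*P-distribˡ-+P (a ∷ p) q r = ≋-trans
  (+P-cong (scale-distrib-+P a q r) (∷-cong (≡.sym (ℤ.+-identityʳ (+ 0))) (*P-distribˡ-+P p q r)))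
  (+P-interchange (scale a q) (scale a r) (+ 0 ∷ p *P q) (+ 0 ∷ p *P r))

*P-zeroʳ : ∀ p → p *P 0P ≋ 0P
*P-zeroʳ []      = ≋-refl
*P-zeroʳ (a ∷ p) = mk≋ λ { zero → refl ; (suc i) → coeff-≡ (*P-zeroʳ p) i }

*P-constʳ : ∀ p a → p *P (a ∷ []) ≋ scale a p
*P-constʳ []      a = ≋-refl
*P-constʳ (b ∷ p) a = ∷-cong (≡.trans (ℤ.+-identityʳ (b ℤ.* a)) (ℤ.*-comm b a)) (*P-constʳ p a)

*P-shiftʳ : ∀ p q → p *P (+ 0 ∷ q) ≋ + 0 ∷ p *P q
*P-shiftʳ []      q = mk≋ λ { zero → refl ; (suc i) → refl }
*P-shiftʳ (b ∷ p) q =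
  ∷-cong (≡.trans (ℤ.+-identityʳ (b ℤ.* + 0)) (ℤ.*-zeroʳ b)) (+P-cong ≋-refl (*P-shiftʳ p q))

*P-comm : ∀ p q → p *P q ≋ q *P p
*P-comm []      q = ≋-sym (*P-zeroʳ q)
*P-comm (a ∷ p) q = ≋-sym (≋-trans (*P-congʳ q split) (≋-trans (*P-distribˡ-+P q (a ∷ []) (+ 0 ∷ p))
  (+P-cong (*P-constʳ q a) (≋-trans (*P-shiftʳ q p) (∷-cong refl (*P-comm q p))))))
  where
  split : (a ∷ p) ≋ (a ∷ []) +P (+ 0 ∷ p)
  split = ∷-cong (≡.sym (ℤ.+-identityʳ a)) ≋-refl

*P-congˡ : ∀ {p p′} q → p ≋ p′ → p *P q ≋ p′ *P q
*P-congˡ {p} {p′} q p≋p′ = ≋-trans (*P-comm p q) (≋-trans (*P-congʳ q p≋p′) (*P-comm q p′))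

*P-cong : ∀ {p p′ q q′} → p ≋ p′ → q ≋ q′ → p *P q ≋ p′ *P q′
*P-cong {p} {p′} {q} p≋p′ q≋q′ = ≋-trans (*P-congˡ q p≋p′) (*P-congʳ p′ q≋q′)

*P-distribʳ-+P : ∀ p q r → (q +P r) *P p ≋ q *P p +P r *P p
*P-distribʳ-+P p q r = ≋-trans (*P-comm (q +P r) p)
  (≋-trans (*P-distribˡ-+P p q r) (+P-cong (*P-comm p q) (*P-comm p r)))

scale-*Pˡ : ∀ a p q → scale a p *P q ≋ scale a (p *P q)
scale-*Pˡ a []      q = ≋-refl
scale-*Pˡ a (b ∷ p) q = ≋-trans
  (+P-cong (≋-sym (scale-scale a b q)) (∷-cong (≡.sym (ℤ.*-zeroʳ a)) (scale-*Pˡ a p q)))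
  (≋-sym (scale-distrib-+P a (scale b q) (+ 0 ∷ p *P q)))

*P-assoc : ∀ p q r → (p *P q) *P r ≋ p *P (q *P r)
*P-assoc []      q r = ≋-refl
*P-assoc (a ∷ p) q r = ≋-trans (*P-distribʳ-+P r (scale a q) (+ 0 ∷ p *P q))
  (+P-cong (scale-*Pˡ a q r) (+P-cong (scale-zero r) (∷-cong refl (*P-assoc p q r))))

*P-identityˡ : ∀ p → 1P *P p ≋ p
*P-identityˡ p = ≋-trans (+P-cong (scale-one p) [0]≋0P) (+P-identityʳ p)
  where
  [0]≋0P : + 0 ∷ [] ≋ 0P
  [0]≋0P = mk≋ λ { zero → refl ; (suc i) → refl }

ℤ[t] : CommutativeRing 0ℓ 0ℓ
ℤ[t] = record
  { Carrier = Poly ; _≈_ = _≋_ ; _+_ = _+P_ ; _*_ = _*P_ ; -_ = negP ; 0# = 0P ; 1# = 1P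
  ; isCommutativeRing = record
    { isRing = record
      { +-isAbelianGroup = record
        { isGroup = record
          { isMonoid = record
            { isSemigroup = record
              { isMagma = record
                { isEquivalence = record { refl = ≋-refl ; sym = ≋-sym ; trans = ≋-trans }
                ; ∙-cong = +P-cong }
              ; assoc = +P-assoc }
            ; identity = (λ p → ≋-refl) , +P-identityʳ }
          ; inverse = (λ p → ≋-trans (+P-comm (negP p) p) (+P-inverseʳ p)) , +P-inverseʳ
          ; ⁻¹-cong = scale-cong _ }
        ; comm = +P-comm }
      ; *-cong = *P-cong
      ; *-assoc = *P-assoc
      ; *-identity = *P-identityˡ , (λ p → ≋-trans (*P-comm p 1P) (*P-identityˡ p))
      ; distrib = *P-distribˡ-+P , *P-distribʳ-+P }
    ; *-comm = *P-comm } }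

open CommutativeRing ℤ[t] using (setoid; *-commutativeSemigroup)
open import Relation.Binary.Reasoning.Setoid setoid
open import Algebra.Properties.CommutativeSemigroup.Divisibility *-commutativeSemigroup
  using (_,_; ∣ʳ-trans; ∣ʳ-respˡ-≈; ∣ʳ-respʳ-≈; xy≈z⇒x∣z)
  renaming (_∣_ to _∣ₚ_)

-- Lets the solver cancel integer constants such as 1 - 1.
zero-test : ∀ p → Maybe (0P ≋ p)
zero-test []       = just ≋-refl
zero-test (+0 ∷ p) with zero-test p
... | just 0≋p = just (mk≋ λ { zero → refl ; (suc i) → coeff-≡ 0≋p i })
... | nothing  = nothing
zero-test (_ ∷ _)  = nothing

ℤ[t]-solver : AlmostCommutativeRing 0ℓ 0ℓ
ℤ[t]-solver = fromCommutativeRing ℤ[t] zero-test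

-- Finite sums

sumNat-cong : ∀ n {f g} → (∀ j → f j ≋ g j) → sumNat n f ≋ sumNat n g
sumNat-cong zero    f≋g = ≋-refl
sumNat-cong (suc n) f≋g = +P-cong (sumNat-cong n f≋g) (f≋g n)

sumNat-zero : ∀ n f → (∀ j → j < n → f j ≋ 0P) → sumNat n f ≋ 0P
sumNat-zero zero    f f≋0 = ≋-refl
sumNat-zero (suc n) f f≋0 = +P-cong (sumNat-zero n f λ j j<n → f≋0 j (ℕ.m<n⇒m<1+n j<n)) (f≋0 n ℕ.≤-refl)

sumNat-+ : ∀ a b f → sumNat (a ℕ.+ b) f ≋ sumNat a f +P sumNat b (λ j → f (a ℕ.+ j))
sumNat-+ a zero    f = ≋-trans (≡⇒≋ (cong (λ n → sumNat n f) (ℕ.+-identityʳ a))) (≋-sym (+P-identityʳ _))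
sumNat-+ a (suc b) f = ≋-trans (≡⇒≋ (cong (λ n → sumNat n f) (ℕ.+-suc a b)))
  (≋-trans (+P-cong (sumNat-+ a b f) ≋-refl) (+P-assoc (sumNat a f) _ _))

sumNat-*P : ∀ n c f → sumNat n (λ j → c *P f j) ≋ c *P sumNat n f
sumNat-*P zero    c f = ≋-sym (*P-zeroʳ c)
sumNat-*P (suc n) c f = ≋-trans (+P-cong (sumNat-*P n c f) ≋-refl) (≋-sym (*P-distribˡ-+P c (sumNat n f) (f n)))

sumFin-cong : ∀ n {f g} → (∀ i → f i ≋ g i) → sumFin n f ≋ sumFin n g
sumFin-cong zero    f≋g = ≋-refl
sumFin-cong (suc n) f≋g = +P-cong (f≋g Fin.zero) (sumFin-cong n (λ i → f≋g (Fin.suc i)))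

sumFin-zero : ∀ n f → (∀ i → f i ≋ 0P) → sumFin n f ≋ 0P
sumFin-zero zero    f f≋0 = ≋-refl
sumFin-zero (suc n) f f≋0 = +P-cong (f≋0 Fin.zero) (sumFin-zero n (λ i → f (Fin.suc i)) (λ i → f≋0 (Fin.suc i)))

sumFin-+P : ∀ n f g → sumFin n (λ i → f i +P g i) ≋ sumFin n f +P sumFin n g
sumFin-+P zero    f g = ≋-refl
sumFin-+P (suc n) f g = ≋-trans (+P-cong ≋-refl (sumFin-+P n (λ i → f (Fin.suc i)) (λ i → g (Fin.suc i))))
  (+P-interchange (f Fin.zero) (g Fin.zero) _ _)

δ : ∀ {n} → Fin n → Fin n → Poly
δ i j = if does (i ≟ j) then 1P else 0P

δ-refl : ∀ {n} (i : Fin n) → δ i i ≡ 1P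
δ-refl i = cong (if_then 1P else 0P) (dec-true (i ≟ i) refl)

δ-≢ : ∀ {n} {i j : Fin n} → i ≢ j → δ i j ≡ 0P
δ-≢ {i = i} {j} i≢j = cong (if_then 1P else 0P) (dec-false (i ≟ j) i≢j)

sumFin-δ : ∀ n (j : Fin n) f → sumFin n (λ i → δ i j *P f i) ≋ f j
sumFin-δ (suc n) Fin.zero    f = ≋-trans
  (+P-cong (*P-identityˡ (f Fin.zero)) (sumFin-zero n _ λ i → ≋-refl))
  (+P-identityʳ (f Fin.zero))
sumFin-δ (suc n) (Fin.suc j) f = sumFin-δ n j (λ i → f (Fin.suc i))

sumFin-δ+δ : ∀ n (j j′ : Fin n) (A B : Poly) (f : Fin n → Poly) →
  sumFin n (λ i → (δ i j *P A +P δ i j′ *P B) *P f i) ≋ A *P f j +P B *P f j′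
sumFin-δ+δ n j j′ A B f = begin
  sumFin n (λ i → (δ i j *P A +P δ i j′ *P B) *P f i)
    ≈⟨ sumFin-cong n (λ i → distribute (δ i j) A (δ i j′) B (f i)) ⟩
  sumFin n (λ i → δ i j *P (A *P f i) +P δ i j′ *P (B *P f i))
    ≈⟨ sumFin-+P n (λ i → δ i j *P (A *P f i)) (λ i → δ i j′ *P (B *P f i)) ⟩
  sumFin n (λ i → δ i j *P (A *P f i)) +P sumFin n (λ i → δ i j′ *P (B *P f i))
    ≈⟨ +P-cong (sumFin-δ n j (λ i → A *P f i)) (sumFin-δ n j′ (λ i → B *P f i)) ⟩
  A *P f j +P B *P f j′ ∎
  where
  distribute : ∀ a A b B x → (a *P A +P b *P B) *P x ≋ a *P (A *P x) +P b *P (B *P x)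
  distribute = solve-∀ ℤ[t]-solver

-- Geometric sums

^P-congˡ : ∀ n {x y} → x ≋ y → x ^P n ≋ y ^P n
^P-congˡ zero    x≋y = ≋-refl
^P-congˡ (suc n) {x} {y} x≋y = ≋-trans (*P-congˡ (x ^P n) x≋y) (*P-congʳ y (^P-congˡ n x≋y))

^P-homo-+ : ∀ x a b → x ^P (a ℕ.+ b) ≋ x ^P a *P x ^P b
^P-homo-+ x zero    b = ≋-sym (*P-identityˡ (x ^P b))
^P-homo-+ x (suc a) b = ≋-trans (*P-congʳ x (^P-homo-+ x a b)) (≋-sym (*P-assoc x (x ^P a) (x ^P b)))

^P-assocʳ : ∀ x a b → (x ^P a) ^P b ≋ x ^P (a ℕ.* b)
^P-assocʳ x a zero    = ≡⇒≋ (cong (x ^P_) (≡.sym (ℕ.*-zeroʳ a)))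
^P-assocʳ x a (suc b) = begin
  x ^P a *P (x ^P a) ^P b     ≈⟨ *P-congʳ (x ^P a) (^P-assocʳ x a b) ⟩
  x ^P a *P x ^P (a ℕ.* b)    ≈⟨ ^P-homo-+ x a (a ℕ.* b) ⟨
  x ^P (a ℕ.+ a ℕ.* b)        ≡⟨ cong (x ^P_) (ℕ.*-suc a b) ⟨
  x ^P (a ℕ.* suc b)          ∎

geomSum : Poly → ℕ → Poly
geomSum y k = sumNat k (y ^P_)

geomSum-cong : ∀ {y y′} k → y ≋ y′ → geomSum y k ≋ geomSum y′ k
geomSum-cong k y≋y′ = sumNat-cong k λ j → ^P-congˡ j y≋y′

geomSum-telescope : ∀ y k → geomSum y k *P (y -P 1P) ≋ y ^P k -P 1P
geomSum-telescope y zero    = ≋-sym (+P-inverseʳ 1P)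
geomSum-telescope y (suc k) = begin
  (geomSum y k +P y ^P k) *P (y -P 1P)            ≈⟨ *P-distribʳ-+P (y -P 1P) (geomSum y k) (y ^P k) ⟩
  geomSum y k *P (y -P 1P) +P y ^P k *P (y -P 1P) ≈⟨ +P-cong (geomSum-telescope y k) ≋-refl ⟩
  (y ^P k -P 1P) +P y ^P k *P (y -P 1P)           ≈⟨ telescope y (y ^P k) ⟩
  y *P y ^P k -P 1P                               ∎
  where
  telescope : ∀ y Y → (Y -P 1P) +P Y *P (y -P 1P) ≋ y *P Y -P 1P
  telescope = solve-∀ ℤ[t]-solver

geomSum-+ : ∀ y a b → geomSum y (a ℕ.+ b) ≋ geomSum y a +P y ^P a *P geomSum y b
geomSum-+ y a b = begin
  geomSum y (a ℕ.+ b)                                         ≈⟨ sumNat-+ a b (y ^P_) ⟩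
  geomSum y a +P sumNat b (λ j → y ^P (a ℕ.+ j))              ≈⟨ +P-cong ≋-refl (sumNat-cong b (^P-homo-+ y a)) ⟩
  geomSum y a +P sumNat b (λ j → y ^P a *P y ^P j)            ≈⟨ +P-cong ≋-refl (sumNat-*P b (y ^P a) (y ^P_)) ⟩
  geomSum y a +P y ^P a *P geomSum y b                        ∎

geomSum-* : ∀ y k l → geomSum y (k ℕ.* l) ≋ geomSum y k *P geomSum (y ^P k) l
geomSum-* y k zero    = ≋-trans (≡⇒≋ (cong (geomSum y) (ℕ.*-zeroʳ k))) (≋-sym (*P-zeroʳ (geomSum y k)))
geomSum-* y k (suc l) = begin
  geomSum y (k ℕ.* suc l)                                    ≡⟨ cong (geomSum y) (≡.trans (ℕ.*-suc k l) (ℕ.+-comm k (k ℕ.* l))) ⟩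
  geomSum y (k ℕ.* l ℕ.+ k)                                  ≈⟨ geomSum-+ y (k ℕ.* l) k ⟩
  geomSum y (k ℕ.* l) +P y ^P (k ℕ.* l) *P geomSum y k       ≈⟨ +P-cong (geomSum-* y k l) (*P-congˡ G (≋-sym (^P-assocʳ y k l))) ⟩
  G *P geomSum Y l +P Y ^P l *P G                            ≈⟨ factor G (geomSum Y l) (Y ^P l) ⟩
  G *P (geomSum Y l +P Y ^P l)                               ∎
  where
  G = geomSum y k
  Y = y ^P k
  factor : ∀ a b c → a *P b +P c *P a ≋ a *P (b +P c)
  factor = solve-∀ ℤ[t]-solver

geomSum-rec : ∀ y l k →
  geomSum y (l ℕ.+ l ℕ.+ k) ≋ (1P +P y ^P l) *P geomSum y (l ℕ.+ k) +P negP (y ^P l) *P geomSum y k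
geomSum-rec y l k = begin
  geomSum y (l ℕ.+ l ℕ.+ k)                      ≡⟨ cong (geomSum y) (ℕ.+-assoc l l k) ⟩
  geomSum y (l ℕ.+ (l ℕ.+ k))                    ≈⟨ geomSum-+ y l (l ℕ.+ k) ⟩
  G +P Y *P geomSum y (l ℕ.+ k)                  ≈⟨ +P-cong ≋-refl (*P-congʳ Y (geomSum-+ y l k)) ⟩
  G +P Y *P (G +P Y *P H)                        ≈⟨ rearrange G H Y ⟩
  (1P +P Y) *P (G +P Y *P H) +P negP Y *P H      ≈⟨ +P-cong (*P-congʳ (1P +P Y) (geomSum-+ y l k)) ≋-refl ⟨
  (1P +P Y) *P geomSum y (l ℕ.+ k) +P negP Y *P H ∎
  where
  G = geomSum y l
  H = geomSum y k
  Y = y ^P l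
  rearrange : ∀ G H Y → G +P Y *P (G +P Y *P H) ≋ (1P +P Y) *P (G +P Y *P H) +P negP Y *P H
  rearrange = solve-∀ ℤ[t]-solver

-- Comaximality and divisibility of geometric sums

Comaximal : Poly → Poly → Set
Comaximal f g = ∃₂ λ r s → r *P f +P s *P g ≋ 1P

comaximal-sym : ∀ {f g} → Comaximal f g → Comaximal g f
comaximal-sym {f} {g} (r , s , rf+sg≋1) = s , r , ≋-trans (+P-comm (s *P g) (r *P f)) rf+sg≋1

comaximal-∣ : ∀ {f g h} → Comaximal f g → f ∣ₚ g *P h → f ∣ₚ h
comaximal-∣ {f} {g} {h} (r , s , rf+sg≋1) (q , qf≋gh) = r *P h +P s *P q , (begin
  (r *P h +P s *P q) *P f        ≈⟨ expand r s h q f ⟩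
  r *P f *P h +P s *P (q *P f)   ≈⟨ +P-cong ≋-refl (*P-congʳ s qf≋gh) ⟩
  r *P f *P h +P s *P (g *P h)   ≈⟨ collect r s f g h ⟩
  (r *P f +P s *P g) *P h        ≈⟨ *P-congˡ h rf+sg≋1 ⟩
  1P *P h                        ≈⟨ *P-identityˡ h ⟩
  h                              ∎)
  where
  expand : ∀ r s h q f → (r *P h +P s *P q) *P f ≋ r *P f *P h +P s *P (q *P f)
  expand = solve-∀ ℤ[t]-solver
  collect : ∀ r s f g h → r *P f *P h +P s *P (g *P h) ≋ (r *P f +P s *P g) *P h
  collect = solve-∀ ℤ[t]-solver

-- The Bézout relation 1 + y q = x p between the lengths lifts to one
-- between the geometric sums, since geomSum X (x p) and geomSum X (1 + y q)
-- factor through geomSum X p and geomSum X q respectively.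
geomSum-comaximal-Bézout : ∀ X {p q} x y → 1 ℕ.+ y ℕ.* q ≡ x ℕ.* p →
  Comaximal (geomSum X p) (geomSum X q)
geomSum-comaximal-Bézout X {p} {q} x y bézout = F′ , negP (Z *P H′) , (begin
  F′ *P F +P negP (Z *P H′) *P H              ≈⟨ rearrange F F′ Z H H′ ⟩
  F *P F′ -P Z *P (H *P H′)                   ≈⟨ +P-cong lifted ≋-refl ⟩
  (1P +P Z *P (H *P H′)) -P Z *P (H *P H′)    ≈⟨ cancel (Z *P (H *P H′)) ⟩
  1P                                          ∎)
  where
  F = geomSum X p
  F′ = geomSum (X ^P p) x
  H = geomSum X q
  H′ = geomSum (X ^P q) y
  Z = X ^P 1
  lifted : F *P F′ ≋ 1P +P Z *P (H *P H′)
  lifted = begin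
    F *P F′                       ≈⟨ geomSum-* X p x ⟨
    geomSum X (p ℕ.* x)           ≡⟨ cong (geomSum X) (≡.trans (ℕ.*-comm p x) (≡.sym bézout)) ⟩
    geomSum X (1 ℕ.+ y ℕ.* q)     ≈⟨ geomSum-+ X 1 (y ℕ.* q) ⟩
    1P +P Z *P geomSum X (y ℕ.* q) ≡⟨ cong (λ k → 1P +P Z *P geomSum X k) (ℕ.*-comm y q) ⟩
    1P +P Z *P geomSum X (q ℕ.* y) ≈⟨ +P-cong ≋-refl (*P-congʳ Z (geomSum-* X q y)) ⟩
    1P +P Z *P (H *P H′)          ∎
  rearrange : ∀ F F′ Z H H′ → F′ *P F +P negP (Z *P H′) *P H ≋ F *P F′ -P Z *P (H *P H′)
  rearrange = solve-∀ ℤ[t]-solver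
  cancel : ∀ W → (1P +P W) -P W ≋ 1P
  cancel = solve-∀ ℤ[t]-solver

geomSum-comaximal : ∀ X {p q} → Coprime p q → Comaximal (geomSum X p) (geomSum X q)
geomSum-comaximal X p⊥q with coprime-Bézout p⊥q
... | Bézout.+- x y bézout = geomSum-comaximal-Bézout X x y bézout
... | Bézout.-+ x y bézout = comaximal-sym (geomSum-comaximal-Bézout X y x bézout)

geomSum-∣-geomSum : ∀ Y {p q} → p ∣ q → geomSum Y p ∣ₚ geomSum Y q
geomSum-∣-geomSum Y {p} (divides r refl) = xy≈z⇒x∣z (geomSum Y p) (geomSum (Y ^P p) r)
  (≋-trans (≋-sym (geomSum-* Y p r)) (≡⇒≋ (cong (geomSum Y) (ℕ.*-comm p r))))

geomSum-∣-geomSum-^ : ∀ X {p c} → Coprime p c → geomSum X p ∣ₚ geomSum (X ^P c) p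
geomSum-∣-geomSum-^ X {p} {c} p⊥c = comaximal-∣ (geomSum-comaximal X p⊥c)
  (xy≈z⇒x∣z (geomSum X p) (geomSum (X ^P p) c) (begin
    geomSum X p *P geomSum (X ^P p) c   ≈⟨ geomSum-* X p c ⟨
    geomSum X (p ℕ.* c)                 ≡⟨ cong (geomSum X) (ℕ.*-comm p c) ⟩
    geomSum X (c ℕ.* p)                 ≈⟨ geomSum-* X c p ⟩
    geomSum X c *P geomSum (X ^P c) p   ∎))

geomSum-∣ : ∀ X {p c q} → Coprime p c → p ∣ q → geomSum X p ∣ₚ geomSum (X ^P c) q
geomSum-∣ X p⊥c p∣q = ∣ʳ-trans (geomSum-∣-geomSum-^ X p⊥c) (geomSum-∣-geomSum _ p∣q)

-- The recurrence has order 2L, with c_L = A, c_{2L} = B and all other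
-- coefficients zero.
twoTermRec⇒SatisfiesLinRec : ∀ {u} L .{{_ : NonZero L}} (A B : Poly) → ¬ (B ≈ 0P) →
  (∀ n → u (L ℕ.+ L ℕ.+ n) ≋ A *P u (L ℕ.+ n) +P B *P u n) → SatisfiesLinRec u
twoTermRec⇒SatisfiesLinRec {u} (suc l) A B B≉0 rec = k , c , c-last≉0 , λ n → coeff-≡ (recurrence n)
  where
  k = l ℕ.+ suc l
  iA iB : Fin (suc k)
  l<1+k : l < suc k
  l<1+k = ℕ.s≤s (ℕ.m≤m+n l (suc l))
  iA = fromℕ< l<1+k
  iB = fromℕ k
  c : Fin (suc k) → Poly
  c i = δ i iA *P A +P δ i iB *P B

  c-last≉0 : ¬ (c iB ≈ 0P)
  c-last≉0 c≈0 = B≉0 (coeff-≡ (begin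
    B                     ≈⟨ only-B A B ⟨
    0P *P A +P 1P *P B    ≡⟨ cong₂ (λ a b → a *P A +P b *P B) (δ-≢ iB≢iA) (δ-refl iB) ⟨
    c iB                  ≈⟨ mk≋ c≈0 ⟩
    0P                    ∎))
    where
    only-B : ∀ A B → 0P *P A +P 1P *P B ≋ B
    only-B = solve-∀ ℤ[t]-solver
    iB≢iA : iB ≢ iA
    iB≢iA iB≡iA = ℕ.m+1+n≢m l (≡.trans (≡.sym (toℕ-fromℕ k)) (≡.trans (cong toℕ iB≡iA) (toℕ-fromℕ< l<1+k)))

  v : ℕ → Fin (suc k) → Poly
  v n i = u ((suc k ℕ.+ n) ∸ suc (toℕ i))

  v-iA : ∀ n → v n iA ≡ u (suc l ℕ.+ n)
  v-iA n = cong u (≡.trans (cong (λ j → (suc k ℕ.+ n) ∸ suc j) (toℕ-fromℕ< l<1+k))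
    (≡.trans (cong (_∸ suc l) (ℕ.+-assoc (suc l) (suc l) n)) (ℕ.m+n∸m≡n (suc l) (suc l ℕ.+ n))))

  v-iB : ∀ n → v n iB ≡ u n
  v-iB n = cong u (≡.trans (cong (λ j → (suc k ℕ.+ n) ∸ suc j) (toℕ-fromℕ k)) (ℕ.m+n∸m≡n (suc k) n))

  recurrence : ∀ n → u (suc k ℕ.+ n) ≋ sumFin (suc k) (λ i → c i *P v n i)
  recurrence n = begin
    u (suc k ℕ.+ n)                         ≈⟨ rec n ⟩
    A *P u (suc l ℕ.+ n) +P B *P u n        ≡⟨ cong₂ (λ x y → A *P x +P B *P y) (v-iA n) (v-iB n) ⟨
    A *P v n iA +P B *P v n iB              ≈⟨ sumFin-δ+δ (suc k) iA iB A B (v n) ⟨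
    sumFin (suc k) (λ i → c i *P v n i)     ∎

-- The sequence u

tP*P-shift : ∀ q → tP *P q ≋ + 0 ∷ q
tP*P-shift q = +P-cong (scale-zero q) (∷-cong refl (*P-identityˡ q))

coeff[tⁿ,n]≡1 : ∀ n → coeff (tP ^P n) n ≡ + 1
coeff[tⁿ,n]≡1 zero    = refl
coeff[tⁿ,n]≡1 (suc n) = ≡.trans (coeff-≡ (tP*P-shift (tP ^P n)) (suc n)) (coeff[tⁿ,n]≡1 n)

-tⁿ≉0 : ∀ n → ¬ (negP (tP ^P n) ≈ 0P)
-tⁿ≉0 n -tⁿ≈0 with ≡.trans (≡.sym (-tⁿ≈0 n))
  (≡.trans (coeff-scale (ℤ.- + 1) (tP ^P n) n) (cong (ℤ._*_ (ℤ.- + 1)) (coeff[tⁿ,n]≡1 n)))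
... | ()

gcd[m+n,m]≡gcd[n,m] : ∀ m n → gcd (m ℕ.+ n) m ≡ gcd n m
gcd[m+n,m]≡gcd[n,m] m n = GCD.unique (gcd-GCD (m ℕ.+ n) m) (GCD.sym (GCD.step (GCD.sym (gcd-GCD n m))))

gcd-nonZero : ∀ n M .{{_ : NonZero M}} → NonZero (gcd n M)
gcd-nonZero n M = ℕ.≢-nonZero (gcd[m,n]≢0 n M (inj₂ (ℕ.≢-nonZero⁻¹ M)))

monomialIfMultiple : ℕ → ℕ → Poly
monomialIfMultiple d j = if does (d ∣? j) then tP ^P j else 0P

sumNat-multiples : ∀ d .{{_ : NonZero d}} k → sumNat (k ℕ.* d) (monomialIfMultiple d) ≋ geomSum (tP ^P d) k
sumNat-multiples (suc e) zero    = ≋-refl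
sumNat-multiples d@(suc e) (suc k) = begin
  sumNat (d ℕ.+ k ℕ.* d) f                                    ≡⟨ cong (λ N → sumNat N f) (ℕ.+-comm d (k ℕ.* d)) ⟩
  sumNat (k ℕ.* d ℕ.+ d) f                                    ≈⟨ sumNat-+ (k ℕ.* d) d f ⟩
  sumNat (k ℕ.* d) f +P sumNat d (λ j → f (k ℕ.* d ℕ.+ j))    ≈⟨ +P-cong (sumNat-multiples d k) block ⟩
  geomSum (tP ^P d) k +P (tP ^P d) ^P k                       ∎
  where
  f = monomialIfMultiple d
  first : f (k ℕ.* d ℕ.+ 0) ≋ (tP ^P d) ^P k
  first = begin
    f (k ℕ.* d ℕ.+ 0)       ≡⟨ cong (if_then tP ^P (k ℕ.* d ℕ.+ 0) else 0P) (dec-true (d ∣? _) (divides k (ℕ.+-identityʳ _))) ⟩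
    tP ^P (k ℕ.* d ℕ.+ 0)   ≡⟨ cong (tP ^P_) (≡.trans (ℕ.+-identityʳ _) (ℕ.*-comm k d)) ⟩
    tP ^P (d ℕ.* k)         ≈⟨ ^P-assocʳ tP d k ⟨
    (tP ^P d) ^P k          ∎
  others : ∀ j → j < e → f (k ℕ.* d ℕ.+ suc j) ≋ 0P
  others j j<e = ≡⇒≋ (cong (if_then tP ^P (k ℕ.* d ℕ.+ suc j) else 0P) (dec-false (d ∣? _) d∤))
    where
    d∤ : ¬ (d ∣ k ℕ.* d ℕ.+ suc j)
    d∤ d∣ = ℕ.<⇒≱ (ℕ.s≤s j<e) (ℕ.∣⇒≤ (ℕ.∣m+n∣m⇒∣n d∣ (ℕ.n∣m*n k)))
  block : sumNat d (λ j → f (k ℕ.* d ℕ.+ j)) ≋ (tP ^P d) ^P k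
  block = begin
    sumNat (1 ℕ.+ e) (λ j → f (k ℕ.* d ℕ.+ j))                     ≈⟨ sumNat-+ 1 e _ ⟩
    f (k ℕ.* d ℕ.+ 0) +P sumNat e (λ j → f (k ℕ.* d ℕ.+ suc j))    ≈⟨ +P-cong first (sumNat-zero e _ others) ⟩
    (tP ^P d) ^P k +P 0P                                           ≈⟨ +P-identityʳ _ ⟩
    (tP ^P d) ^P k                                                 ∎

uSeq-geomSum : ∀ M .{{_ : NonZero M}} n k {d} → gcd n M ≡ d → n ≡ k ℕ.* d → uSeq M n ≋ geomSum (tP ^P d) k
uSeq-geomSum M n k refl n≡kd = ≋-trans (≡⇒≋ (cong (λ N → sumNat N (monomialIfMultiple (gcd n M))) n≡kd))
  (sumNat-multiples (gcd n M) ⦃ gcd-nonZero n M ⦄ k)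

uSeq-quotient : ∀ M .{{_ : NonZero M}} n → uSeq M n *P (tP ^P gcd n M -P 1P) ≋ tP ^P n -P 1P
uSeq-quotient M n with gcd[m,n]∣m n M
... | divides k n≡kd = begin
  uSeq M n *P (y -P 1P)        ≈⟨ *P-congˡ (y -P 1P) (uSeq-geomSum M n k refl n≡kd) ⟩
  geomSum y k *P (y -P 1P)     ≈⟨ geomSum-telescope y k ⟩
  y ^P k -P 1P                 ≈⟨ +P-cong (^P-assocʳ tP (gcd n M) k) ≋-refl ⟩
  tP ^P (gcd n M ℕ.* k) -P 1P  ≡⟨ cong (λ N → tP ^P N -P 1P) (≡.trans (ℕ.*-comm (gcd n M) k) (≡.sym n≡kd)) ⟩
  tP ^P n -P 1P                ∎
  where
  y = tP ^P gcd n M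

uSeq-rec : ∀ M .{{_ : NonZero M}} n →
  uSeq M (M ℕ.+ M ℕ.+ n) ≋ (1P +P tP ^P M) *P uSeq M (M ℕ.+ n) +P negP (tP ^P M) *P uSeq M n
uSeq-rec M n with gcd[m,n]∣m n M | gcd[m,n]∣n n M
... | divides k n≡kd | divides l M≡ld = begin
  uSeq M (M ℕ.+ M ℕ.+ n)                                       ≈⟨ uSeq-geomSum M _ (l ℕ.+ l ℕ.+ k) gcd₂ M+M+n≡ ⟩
  geomSum y (l ℕ.+ l ℕ.+ k)                                    ≈⟨ geomSum-rec y l k ⟩
  (1P +P y ^P l) *P geomSum y (l ℕ.+ k) +P negP (y ^P l) *P geomSum y k
    ≈⟨ +P-cong (*P-cong (+P-cong (≋-refl {1P}) y^l≋t^M) (≋-sym (uSeq-geomSum M _ (l ℕ.+ k) gcd₁ M+n≡)))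
               (*P-cong (scale-cong _ y^l≋t^M) (≋-sym (uSeq-geomSum M n k refl n≡kd))) ⟩
  (1P +P tP ^P M) *P uSeq M (M ℕ.+ n) +P negP (tP ^P M) *P uSeq M n ∎
  where
  d = gcd n M
  y = tP ^P d
  gcd₁ : gcd (M ℕ.+ n) M ≡ d
  gcd₁ = gcd[m+n,m]≡gcd[n,m] M n
  gcd₂ : gcd (M ℕ.+ M ℕ.+ n) M ≡ d
  gcd₂ = ≡.trans (cong (λ x → gcd x M) (ℕ.+-assoc M M n)) (≡.trans (gcd[m+n,m]≡gcd[n,m] M (M ℕ.+ n)) gcd₁)
  M+n≡ : M ℕ.+ n ≡ (l ℕ.+ k) ℕ.* d
  M+n≡ = ≡.trans (cong₂ ℕ._+_ M≡ld n≡kd) (≡.sym (ℕ.*-distribʳ-+ d l k))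
  M+M+n≡ : M ℕ.+ M ℕ.+ n ≡ (l ℕ.+ l ℕ.+ k) ℕ.* d
  M+M+n≡ = ≡.trans (ℕ.+-assoc M M n) (≡.trans (cong₂ ℕ._+_ M≡ld M+n≡)
    (≡.trans (≡.sym (ℕ.*-distribʳ-+ d l (l ℕ.+ k))) (cong (ℕ._* d) (≡.sym (ℕ.+-assoc l l k)))))
  y^l≋t^M : y ^P l ≋ tP ^P M
  y^l≋t^M = ≋-trans (^P-assocʳ tP d l) (≡⇒≋ (cong (tP ^P_) (≡.trans (ℕ.*-comm d l) (≡.sym M≡ld))))

uSeq-linRec : ∀ M .{{_ : NonZero M}} → SatisfiesLinRec (uSeq M)
uSeq-linRec M = twoTermRec⇒SatisfiesLinRec M (1P +P tP ^P M) (negP (tP ^P M)) (-tⁿ≉0 M) (uSeq-rec M)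

-- With a = gcd m M: a common divisor i of p and c makes i a divide both
-- m = p a and M, hence a itself.
gcd-cofactors-coprime : ∀ {m M p c} .{{_ : NonZero (gcd m M)}} →
  m ≡ p ℕ.* gcd m M → c ℕ.* gcd m M ∣ M → Coprime p c
gcd-cofactors-coprime {m} {M} m≡pa ca∣M {i} (i∣p , i∣c) = ℕ.∣1⇒≡1 (ℕ.*-cancelʳ-∣ a ia∣1a)
  where
  a = gcd m M
  ia∣1a : i ℕ.* a ∣ 1 ℕ.* a
  ia∣1a = ≡.subst (i ℕ.* a ∣_) (≡.sym (ℕ.*-identityˡ a)) (gcd-greatest
    (≡.subst (i ℕ.* a ∣_) (≡.sym m≡pa) (ℕ.*-monoˡ-∣ a i∣p))
    (ℕ.∣-trans (ℕ.*-monoˡ-∣ a i∣c) ca∣M))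

uSeq-∣ : ∀ M .{{_ : NonZero M}} {m n} → m ∣ n → uSeq M m ∣ₚ uSeq M n
uSeq-∣ M {m} {n} m∣n with gcd[m,n]∣m m M | gcd[m,n]∣m n M | gcd-greatest (ℕ.∣-trans (gcd[m,n]∣m m M) m∣n) (gcd[m,n]∣n m M)
... | divides p m≡pa | divides q n≡qb | divides c b≡ca =
  ∣ʳ-respˡ-≈ (≋-sym um) (∣ʳ-respʳ-≈ (≋-sym un) (geomSum-∣ (tP ^P a) p⊥c p∣q))
  where
  instance
    _ = gcd-nonZero m M
  a = gcd m M
  p⊥c : Coprime p c
  p⊥c = gcd-cofactors-coprime m≡pa (≡.subst (_∣ M) b≡ca (gcd[m,n]∣n n M))
  n≡cq*a : n ≡ (c ℕ.* q) ℕ.* a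
  n≡cq*a = ≡.trans n≡qb (≡.trans (cong (q ℕ.*_) b≡ca)
    (≡.trans (≡.sym (ℕ.*-assoc q c a)) (cong (ℕ._* a) (ℕ.*-comm q c))))
  p∣q : p ∣ q
  p∣q = coprime-divisor p⊥c (ℕ.*-cancelʳ-∣ a (≡.subst₂ _∣_ m≡pa n≡cq*a m∣n))
  um : uSeq M m ≋ geomSum (tP ^P a) p
  um = uSeq-geomSum M m p refl m≡pa
  un : uSeq M n ≋ geomSum ((tP ^P a) ^P c) q
  un = ≋-trans (uSeq-geomSum M n q refl n≡qb) (geomSum-cong q (begin
    tP ^P gcd n M        ≡⟨ cong (tP ^P_) (≡.trans b≡ca (ℕ.*-comm c a)) ⟩
    tP ^P (a ℕ.* c)      ≈⟨ ^P-assocʳ tP a c ⟨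
    (tP ^P a) ^P c       ∎))

-- The hypothesis 1 < M only serves to make M nonzero.
lemma1 : (M : ℕ) → 1 < M →
    (∀ n → uSeq M n *P (tP ^P gcd n M -P 1P) ≈ tP ^P n -P 1P)
    × IsLinearDivisionSeq (uSeq M)
lemma1 M@(suc _) _ =
  (λ n → coeff-≡ (uSeq-quotient M n)) ,
  uSeq-linRec M ,
  λ m n m∣n → let (q , q*um≋un) = uSeq-∣ M m∣n in q , coeff-≡ q*um≋un
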